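{- Let $\chi$ be a Dirichlet character and $\mu$ the Möbius function. Then the sequence $(\mu(n)\chi(n))_{n\geq 1}$ is not $k$-automatic for any integer $k\geq 2$.
   Context: A sequence $(t(n))_{n\geq 1}$ taking values in a finite set is $k$-automatic (for an integer $k\geq 2$) if its $k$-kernel $\{(t(k^l n+r))_{n}: l\geq 0,\ 0\leq r<k^l\}$ is finite. -}

module Defs where

open import Data.Nat using (ℕ; zero; suc; _+_; _*_; _^_; _≤_; _<_; NonZero)
open import Data.Nat.Properties using (m*n≢0)
open import Data.Nat.DivMod using (_mod_)
open import Data.Nat.Divisibility using (_∣_; _∣?_)
open import Data.Nat.GCD using (gcd)
open import Data.Nat.Primality using (prime?)
open import Data.Integer as ℤ using (ℤ; +_; -[1+_])
open import Data.Fin using (Fin; toℕ)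
open import Data.Maybe using (Maybe; just; nothing)
open import Data.List using (List; filter; length; upTo)
open import Data.List.Relation.Unary.Any using (Any)
open import Data.Bool using (if_then_else_)
open import Data.Product using (Σ; ∃-syntax; _×_)
open import Relation.Nullary using (¬_; does)
open import Relation.Nullary.Decidable using (_×-dec_)
open import Relation.Binary.PropositionalEquality using (_≡_; _≢_)
open import Function.Bundles using (_⇔_)

-- Möbius function  μ(n) = 0 if p² ∣ n for some prime p,
--                  μ(n) = (-1)^(number of distinct prime divisors) otherwise.
-- (Primes dividing n ≥ 1 are ≤ n, so searching in [0, n] suffices.)

primeDivisors : ℕ → List ℕ
primeDivisors n = filter (λ p → prime? p ×-dec (p ∣? n)) (upTo (suc n))

primeSquareDivisors : ℕ → List ℕ
primeSquareDivisors n = filter (λ p → prime? p ×-dec ((p * p) ∣? n)) (upTo (suc n))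

minusOnePow : ℕ → ℤ
minusOnePow zero    = + 1
minusOnePow (suc k) = ℤ.- minusOnePow k

möbius : ℕ → ℤ
möbius n with length (primeSquareDivisors n)
... | zero  = minusOnePow (length (primeDivisors n))
... | suc _ = + 0

-- Exact encoding of complex values of the form 0 or e^{2πi a / N}:
--   nothing   ↦ 0
--   just a    ↦ e^{2πi a/N}      (a : Fin N)
-- Distinct codes denote distinct complex numbers.

UnitOrZero : ℕ → Set
UnitOrZero N = Maybe (Fin N)

mulU : ∀ {N} .{{_ : NonZero N}} → UnitOrZero N → UnitOrZero N → UnitOrZero N
mulU {N} (just a) (just b) = just ((toℕ a + toℕ b) mod N)
mulU _ _ = nothing

-- A Dirichlet character modulo q whose values are N-th roots of unity
-- (or 0).  Every complex Dirichlet character mod q arises this way,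
-- e.g. with N = φ(q) (or N = q).
record DirichletCharacter (q N : ℕ) .{{_ : NonZero N}} : Set where
  field
    χ           : ℕ → UnitOrZero N
    periodic    : ∀ n → χ (n + q) ≡ χ n
    multiplicative : ∀ m n → χ (m * n) ≡ mulU (χ m) (χ n)
    vanishing   : ∀ n → (χ n ≡ nothing) ⇔ (gcd n q ≢ 1)

-- The sequence n ↦ μ(n) χ(n), with values 0 or ±e^{2πi a/N},
-- encoded exactly as 0 or e^{2πi b/(2N)}:
--   μ(n)χ(n) = 0                  ↦ nothing
--   +e^{2πi a/N} = e^{2πi 2a/(2N)}  ↦ just (2a mod 2N)
--   -e^{2πi a/N} = e^{2πi (2a+N)/(2N)} ↦ just ((2a + N) mod 2N)
μχ : ∀ {q N} .{{nz : NonZero N}} → DirichletCharacter q N → ℕ → UnitOrZero (2 * N)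
μχ {N = N} {{nz}} X n with möbius n | DirichletCharacter.χ X n
... | _           | nothing = nothing
... | + zero      | just a  = nothing
... | + suc _     | just a  = just (_mod_ (2 * toℕ a) (2 * N) {{m*n≢0 2 N {{_}} {{nz}}}})
... | -[1+ _ ]    | just a  = just (_mod_ (2 * toℕ a + N) (2 * N) {{m*n≢0 2 N {{_}} {{nz}}}})

-- k-automatic sequences.  A sequence (t(n))_{n ≥ 1} is represented by
-- t : ℕ → A, whose value at 0 is ignored.  Two sequences are equal when
-- they agree at every n ≥ 1.

_≋_ : ∀ {A : Set} → (ℕ → A) → (ℕ → A) → Set
s ≋ t = ∀ n → 1 ≤ n → s n ≡ t n

kernelSeq : ∀ {A : Set} → ℕ → ℕ → ℕ → (ℕ → A) → (ℕ → A)
kernelSeq k l r t n = t (k ^ l * n + r)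

IsAutomatic : ∀ {A : Set} → ℕ → (ℕ → A) → Set
IsAutomatic {A} k t =
  Σ (List (ℕ → A)) λ L →
    ∀ l r → r < k ^ l → Any (λ s → kernelSeq k l r t ≋ s) L

{-# OPTIONS --safe #-}
-- If μχ were k-automatic, two of the infinitely many kernel sequences n ↦ μχ(k^{R_j} n + R_j)
-- would coincide.  The levels are built by R_{j+1} = R_j P_j² with P_j = 1 + kq R_j, so that
-- P_i² divides R_j for i < j while R_i is coprime to kq P_i.  Every arithmetic progression with
-- coprime first term and difference contains a square-free term (a counting sieve), so some
-- n = P_i² q (1 + m) makes k^{R_i} n + R_i square-free and prime to q, and μχ is nonzero there;
-- at level j the same n gives an argument divisible by P_i², where μχ vanishes.
module Submission where

open import Defs
open import Data.Fin using (Fin; toℕ)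
open import Data.Fin.Properties using (pigeonhole)
import Data.Integer as ℤ
import Data.Integer.Properties as ℤ
open import Data.List using ([]; _∷_; length; lookup; upTo)
open import Data.List.Membership.Propositional using (lose)
open import Data.List.Membership.Propositional.Properties using (∈-upTo⁺)
open import Data.List.Properties using (filter-none; filter-some)
open import Data.List.Relation.Unary.All as All using (_∷_)
open import Data.List.Relation.Unary.Any as Any using (Any)
open import Data.List.Relation.Unary.Any.Properties using (lookup-index)
open import Data.Maybe using (just; nothing)
open import Data.Nat
open import Data.Nat.Coprimality as Coprime
  using (Coprime; coprime-divisor; 1-coprimeTo; coprime⇒gcd≡1)
open import Data.Nat.Divisibility
open import Data.Nat.DivMod
open import Data.Nat.GCD using (gcd)
open import Data.Nat.ListAction using (product)
open import Data.Nat.Primality using (Prime; prime?; prime⇒nonZero; prime⇒nonTrivial)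
open import Data.Nat.Primality.Factorisation using (factorise)
open import Data.Nat.Properties
open import Algebra.Properties.CommutativeSemigroup +-commutativeSemigroup
  using () renaming (interchange to +-interchange)
open import Data.Nat.Tactic.RingSolver using (solve-∀)
open import Data.Product using (∃; ∃-syntax; ∃₂; _×_; _,_; proj₁; proj₂)
open import Data.Sum using (inj₁; inj₂)
open import Function.Bundles using (Equivalence)
open import Relation.Binary.PropositionalEquality
open import Relation.Nullary using (¬_; Dec; yes; no; contradiction)
open import Relation.Nullary.Decidable using (_×-dec_)
open import Relation.Unary using (Decidable)

sumUpTo : ℕ → (ℕ → ℕ) → ℕ
sumUpTo zero    f = 0
sumUpTo (suc n) f = sumUpTo n f + f n

syntax sumUpTo n (λ i → e) = ∑[ i < n ] e

∑-mono-≤ : ∀ n {f g : ℕ → ℕ} → (∀ i → f i ≤ g i) → ∑[ i < n ] f i ≤ ∑[ i < n ] g i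
∑-mono-≤ zero    f≤g = z≤n
∑-mono-≤ (suc n) f≤g = +-mono-≤ (∑-mono-≤ n f≤g) (f≤g n)

∑-const : ∀ n c → ∑[ i < n ] c ≡ n * c
∑-const zero    c = refl
∑-const (suc n) c = trans (cong (_+ c) (∑-const n c)) (+-comm (n * c) c)

∑-distrib-+ : ∀ n (f g : ℕ → ℕ) → ∑[ i < n ] (f i + g i) ≡ ∑[ i < n ] f i + ∑[ i < n ] g i
∑-distrib-+ zero    f g = refl
∑-distrib-+ (suc n) f g = begin
  ∑[ i < n ] (f i + g i) + (f n + g n)           ≡⟨ cong (_+ (f n + g n)) (∑-distrib-+ n f g) ⟩
  ∑[ i < n ] f i + ∑[ i < n ] g i + (f n + g n)  ≡⟨ +-interchange (∑[ i < n ] f i) _ _ _ ⟩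
  ∑[ i < n ] f i + f n + (∑[ i < n ] g i + g n)  ∎
  where open ≡-Reasoning

∑-comm : ∀ m n (h : ℕ → ℕ → ℕ) → ∑[ i < m ] ∑[ j < n ] h i j ≡ ∑[ j < n ] ∑[ i < m ] h i j
∑-comm m zero    h = trans (∑-const m 0) (*-zeroʳ m)
∑-comm m (suc n) h = begin
  ∑[ i < m ] (∑[ j < n ] h i j + h i n)        ≡⟨ ∑-distrib-+ m _ _ ⟩
  ∑[ i < m ] ∑[ j < n ] h i j + ∑[ i < m ] h i n  ≡⟨ cong (_+ ∑[ i < m ] h i n) (∑-comm m n h) ⟩
  ∑[ j < n ] ∑[ i < m ] h i j + ∑[ i < m ] h i n  ∎
  where open ≡-Reasoning

≤-∑ : ∀ n (f : ℕ → ℕ) {i} → i < n → f i ≤ ∑[ j < n ] f j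
≤-∑ (suc n) f {i} i<1+n with m≤n⇒m<n∨m≡n (s≤s⁻¹ i<1+n)
... | inj₁ i<n  = ≤-trans (≤-∑ n f i<n) (m≤m+n _ _)
... | inj₂ refl = m≤n+m _ _

∑<length⇒zero : ∀ n (f : ℕ → ℕ) → ∑[ i < n ] f i < n → ∃[ i ] i < n × f i ≡ 0
∑<length⇒zero (suc n) f ∑<1+n with f n in fn≡
... | zero  = n , ≤-refl , fn≡
... | suc v with ∑<length⇒zero n f (≤-trans (m≤m+n (suc (∑[ i < n ] f i)) v) ∑+v<n)
  where
  ∑+v<n : suc (∑[ i < n ] f i) + v ≤ n
  ∑+v<n = s≤s⁻¹ (subst (_≤ suc n) (cong suc (+-suc _ v)) ∑<1+n)
...   | i , i<n , fi≡0 = i , m<n⇒m<1+n i<n , fi≡0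

𝟙 : ∀ {P : Set} → Dec P → ℕ
𝟙 (yes _) = 1
𝟙 (no _)  = 0

𝟙≡0⇒¬ : ∀ {P : Set} (P? : Dec P) → 𝟙 P? ≡ 0 → ¬ P
𝟙≡0⇒¬ (no ¬p) _ = ¬p

count : ∀ {P : ℕ → Set} → Decidable P → ℕ → ℕ
count P? T = ∑[ m < T ] 𝟙 (P? m)

module _ {P : ℕ → Set} (P? : Decidable P) (M : ℕ) .{{_ : NonZero M}}
         (sparse : ∀ {a b} → a < b → P a → P b → a + M ≤ b) where

  count-lastHit : ∀ T c → suc c ≤ count P? T → ∃[ h ] h < T × P h × c * M ≤ h
  count-lastHit (suc T) c c<count with P? T
  ... | no _ with count-lastHit T c (≤-trans c<count (≤-reflexive (+-identityʳ _)))
  ...   | h , h<T , Ph , cM≤h = h , m<n⇒m<1+n h<T , Ph , cM≤h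
  count-lastHit (suc T) zero    _       | yes PT = T , ≤-refl , PT , z≤n
  count-lastHit (suc T) (suc c) c<count | yes PT
    with count-lastHit T c (s≤s⁻¹ (≤-trans c<count (≤-reflexive (+-comm _ 1))))
  ... | h , h<T , Ph , cM≤h = T , ≤-refl , PT , (begin
    M + c * M  ≤⟨ +-monoʳ-≤ M cM≤h ⟩
    M + h      ≡⟨ +-comm M h ⟩
    h + M      ≤⟨ sparse h<T Ph PT ⟩
    T          ∎)
    where open ≤-Reasoning

  count≤1+/ : ∀ T → count P? T ≤ suc (T / M)
  count≤1+/ T with count P? T ≤? suc (T / M)
  ... | yes ≤ = ≤
  ... | no ≰ with count-lastHit T (suc (T / M)) (≰⇒> ≰)
  ...   | h , h<T , _ , [1+T/M]M≤h = contradiction (<-trans h<T T<[1+T/M]M) (≤⇒≯ [1+T/M]M≤h)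
    where
    T<[1+T/M]M : T < suc (T / M) * M
    T<[1+T/M]M = begin-strict
      T                  ≡⟨ m≡m%n+[m/n]*n T M ⟩
      T % M + T / M * M  <⟨ +-monoˡ-< (T / M * M) (m%n<n T M) ⟩
      M + T / M * M      ∎
      where open ≤-Reasoning

coprime-∣ˡ : ∀ {m n o} → Coprime m n → o ∣ m → Coprime o n
coprime-∣ˡ coprime o∣m (e∣o , e∣n) = coprime (∣-trans e∣o o∣m , e∣n)

coprime-∣ʳ : ∀ {m n o} → Coprime m n → o ∣ n → Coprime m o
coprime-∣ʳ coprime o∣n = Coprime.sym (coprime-∣ˡ (Coprime.sym coprime) o∣n)

coprime-*ʳ : ∀ {m n o} → Coprime m n → Coprime m o → Coprime m (n * o)
coprime-*ʳ m⊥n m⊥o (e∣m , e∣no) =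
  m⊥o (e∣m , coprime-divisor (coprime-∣ˡ m⊥n e∣m) e∣no)

coprime-^ʳ : ∀ {m n} e → Coprime m n → Coprime m (n ^ e)
coprime-^ʳ zero    m⊥n (_ , e∣1) = ∣1⇒≡1 e∣1
coprime-^ʳ (suc e) m⊥n = coprime-*ʳ m⊥n (coprime-^ʳ e m⊥n)

coprime-+-* : ∀ {m n} o → Coprime m n → Coprime (m + n * o) n
coprime-+-* {m} {n} o m⊥n {e} (e∣m+no , e∣n) =
  m⊥n (∣m+n∣m⇒∣n (subst (e ∣_) (+-comm m (n * o)) e∣m+no) (∣m⇒∣m*n o e∣n) , e∣n)

module _ {y₀ d : ℕ} (y₀⊥d : Coprime y₀ d) where

  progression-multiples-sparse : ∀ {M a b} → .{{NonZero M}} → a < b →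
    M ∣ y₀ + d * a → M ∣ y₀ + d * b → a + M ≤ b
  progression-multiples-sparse {M} {a} {b} a<b M∣ya M∣yb = begin
    a + M        ≤⟨ +-monoʳ-≤ a (∣⇒≤ {{>-nonZero (m<n⇒0<n∸m a<b)}} M∣b∸a) ⟩
    a + (b ∸ a)  ≡⟨ m+[n∸m]≡n (<⇒≤ a<b) ⟩
    b            ∎
    where
    open ≤-Reasoning
    yb≡ya+d[b∸a] : y₀ + d * b ≡ y₀ + d * a + d * (b ∸ a)
    yb≡ya+d[b∸a] = begin-equality
      y₀ + d * b              ≡⟨ cong (λ x → y₀ + d * x) (m+[n∸m]≡n (<⇒≤ a<b)) ⟨
      y₀ + d * (a + (b ∸ a))  ≡⟨ cong (y₀ +_) (*-distribˡ-+ d a (b ∸ a)) ⟩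
      y₀ + (d * a + d * (b ∸ a)) ≡⟨ +-assoc y₀ (d * a) (d * (b ∸ a)) ⟨
      y₀ + d * a + d * (b ∸ a)  ∎
    M∣b∸a : M ∣ b ∸ a
    M∣b∸a = coprime-divisor (coprime-∣ˡ (coprime-+-* a y₀⊥d) M∣ya)
                            (∣m+n∣m⇒∣n (subst (M ∣_) yb≡ya+d[b∸a] M∣yb) M∣ya)

  count-progression-multiples : ∀ M .{{_ : NonZero M}} T →
    count (λ m → M ∣? y₀ + d * m) T ≤ suc (T / M)
  count-progression-multiples M T =
    count≤1+/ (λ m → M ∣? y₀ + d * m) M progression-multiples-sparse T

*≤⇒≤/ : ∀ {m n o} .{{_ : NonZero n}} → m * n ≤ o → m ≤ o / n
*≤⇒≤/ {m} {n} {o} mn≤o = subst (_≤ o / n) (m*n/n≡m m n) (/-monoˡ-≤ n mn≤o)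

/-square-telescope : ∀ T n .{{_ : NonZero n}} → T / (suc n * suc n) + T / suc n ≤ T / n
/-square-telescope T n =
  subst (λ x → x + B ≤ T / n) (m/n/o≡m/[n*o] T (suc n) (suc n)) (*≤⇒≤/ (begin
  (B / suc n + B) * n        ≡⟨ *-distribʳ-+ n (B / suc n) B ⟩
  B / suc n * n + B * n      ≤⟨ +-monoˡ-≤ (B * n) (*-monoʳ-≤ (B / suc n) (n≤1+n n)) ⟩
  B / suc n * suc n + B * n  ≤⟨ +-monoˡ-≤ (B * n) (m/n*n≤m B (suc n)) ⟩
  B + B * n                  ≡⟨ *-suc B n ⟨
  B * suc n                  ≤⟨ m/n*n≤m T (suc n) ⟩
  T                          ∎))
  where
  open ≤-Reasoning
  B = T / suc n

∑-/-squares≤ : ∀ T A → ∑[ a < A ] (T / ((2 + a) * (2 + a))) ≤ T / 4 + T / 2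
∑-/-squares≤ T zero    = z≤n
∑-/-squares≤ T (suc B) = ≤-trans (m≤m+n _ _) (telescope B)
  where
  S : ℕ → ℕ
  S A = ∑[ a < A ] (T / ((2 + a) * (2 + a)))

  telescope : ∀ B → S (suc B) + T / (2 + B) ≤ T / 4 + T / 2
  telescope zero    = ≤-refl
  telescope (suc B) = begin
    S (suc B) + T / ((3 + B) * (3 + B)) + T / (3 + B)    ≡⟨ +-assoc (S (suc B)) _ _ ⟩
    S (suc B) + (T / ((3 + B) * (3 + B)) + T / (3 + B))
      ≤⟨ +-monoʳ-≤ (S (suc B)) (/-square-telescope T (2 + B)) ⟩
    S (suc B) + T / (2 + B)                              ≤⟨ telescope B ⟩
    T / 4 + T / 2                                        ∎
    where open ≤-Reasoning

m*m≤n*n⇒m≤n : ∀ {m n} → m * m ≤ n * n → m ≤ n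
m*m≤n*n⇒m≤n {m} {n} mm≤nn with m ≤? n
... | yes m≤n = m≤n
... | no  m≰n = contradiction mm≤nn (<⇒≱ (*-mono-< (≰⇒> m≰n) (≰⇒> m≰n)))

prime≥2 : ∀ {p} → Prime p → 2 ≤ p
prime≥2 {p} p-prime = nonTrivial⇒n>1 p {{prime⇒nonTrivial p-prime}}

SquareFree : ℕ → Set
SquareFree y = ∀ {n} → 2 ≤ n → ¬ (n * n ∣ y)

-- Sieve the terms y m, m < T = 64 C, by the squares n² with 2 ≤ n ≤ X + 1, where C = y₀ + d
-- and X = 8 C: since y m ≤ X², a term that survives is square-free, and the number of
-- (term, square) incidences is at most Σₙ (1 + T/n²) ≤ X + T/4 + T/2 < T.
module _ {y₀ d : ℕ} (1≤y₀ : 1 ≤ y₀) (y₀⊥d : Coprime y₀ d) where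
  private
    y : ℕ → ℕ
    y m = y₀ + d * m

    C X T : ℕ
    C = y₀ + d
    X = 8 * C
    T = 64 * C

    sieved : ℕ → ℕ → ℕ
    sieved m a = 𝟙 ((2 + a) * (2 + a) ∣? y m)

    1≤C : 1 ≤ C
    1≤C = ≤-trans 1≤y₀ (m≤m+n y₀ d)

    y≤X*X : ∀ {m} → m < T → y m ≤ X * X
    y≤X*X {m} m<T = begin
      y₀ + d * m    ≤⟨ +-mono-≤ (m≤m+n y₀ d) (*-monoˡ-≤ m (m≤n+m d y₀)) ⟩
      C + C * m     ≡⟨ *-suc C m ⟨
      C * suc m     ≤⟨ *-monoʳ-≤ C m<T ⟩
      C * T         ≡⟨ square-identity C ⟩
      X * X         ∎
      where
      open ≤-Reasoning
      square-identity : ∀ C → C * (64 * C) ≡ 8 * C * (8 * C)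
      square-identity = solve-∀

    T/4+T/2 : T / 4 + T / 2 ≡ 16 * C + 32 * C
    T/4+T/2 = cong₂ _+_ (trans (/-congˡ (quarter C)) (m*n/n≡m (16 * C) 4))
                        (trans (/-congˡ (half C)) (m*n/n≡m (32 * C) 2))
      where
      quarter : ∀ C → 64 * C ≡ 16 * C * 4
      quarter = solve-∀
      half : ∀ C → 64 * C ≡ 32 * C * 2
      half = solve-∀

    8C+[16C+32C]<T : 8 * C + (16 * C + 32 * C) < T
    8C+[16C+32C]<T = subst (8 * C + (16 * C + 32 * C) <_) (split C)
                      (m<m+n _ (≤-trans 1≤C (m≤n*m C 8)))
      where
      split : ∀ C → 8 * C + (16 * C + 32 * C) + 8 * C ≡ 64 * C
      split = solve-∀

    incidences<T : ∑[ m < T ] ∑[ a < X ] sieved m a < T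
    incidences<T = begin-strict
      ∑[ m < T ] ∑[ a < X ] sieved m a                  ≡⟨ ∑-comm T X sieved ⟩
      ∑[ a < X ] count (λ m → (2 + a) * (2 + a) ∣? y m) T
        ≤⟨ ∑-mono-≤ X (λ a → count-progression-multiples y₀⊥d ((2 + a) * (2 + a)) T) ⟩
      ∑[ a < X ] (1 + T / ((2 + a) * (2 + a)))
        ≡⟨ ∑-distrib-+ X (λ _ → 1) (λ a → T / ((2 + a) * (2 + a))) ⟩
      ∑[ a < X ] 1 + ∑[ a < X ] (T / ((2 + a) * (2 + a)))
        ≡⟨ cong (_+ ∑[ a < X ] (T / ((2 + a) * (2 + a)))) (trans (∑-const X 1) (*-identityʳ X)) ⟩
      X + ∑[ a < X ] (T / ((2 + a) * (2 + a)))          ≤⟨ +-monoʳ-≤ X (∑-/-squares≤ T X) ⟩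
      X + (T / 4 + T / 2)                                ≡⟨ cong (X +_) T/4+T/2 ⟩
      8 * C + (16 * C + 32 * C)                          <⟨ 8C+[16C+32C]<T ⟩
      T                                                  ∎
      where open ≤-Reasoning

    unsieved⇒squareFree : ∀ {m} → m < T → ∑[ a < X ] sieved m a ≡ 0 → SquareFree (y m)
    unsieved⇒squareFree {m} m<T no-incidence {suc (suc a)} (s≤s (s≤s _)) n²∣y =
      𝟙≡0⇒¬ ((2 + a) * (2 + a) ∣? y m) (n≤0⇒n≡0 sieved≤0) n²∣y
      where
      a<X : a < X
      a<X = <⇒≤ (m*m≤n*n⇒m≤n (≤-trans (∣⇒≤ {{>-nonZero 1≤y}} n²∣y) (y≤X*X m<T)))
        where
        1≤y : 1 ≤ y m
        1≤y = ≤-trans 1≤y₀ (m≤m+n y₀ (d * m))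
      sieved≤0 : sieved m a ≤ 0
      sieved≤0 = ≤-trans (≤-∑ X (sieved m) a<X) (≤-reflexive no-incidence)

  squareFree-in-progression : ∃[ m ] SquareFree (y₀ + d * m)
  squareFree-in-progression =
    let m , m<T , no-incidence = ∑<length⇒zero T (λ m → ∑[ a < X ] sieved m a) incidences<T
    in m , unsieved⇒squareFree m<T no-incidence

prime-factor : ∀ {n} → 2 ≤ n → ∃[ p ] Prime p × p ∣ n
prime-factor {n} 2≤n with factorise n {{>-nonZero (≤-trans (s≤s z≤n) 2≤n)}}
... | record { factors = [] ; isFactorisation = n≡1 } =
  contradiction (subst (2 ≤_) n≡1 2≤n) λ { (s≤s ()) }
... | record { factors = p ∷ ps ; isFactorisation = n≡p*∏ps ; factorsPrime = p-prime ∷ _ } =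
  p , p-prime , divides (product ps) (trans n≡p*∏ps (*-comm p (product ps)))

∣minusOnePow∣≡1 : ∀ k → ℤ.∣ minusOnePow k ∣ ≡ 1
∣minusOnePow∣≡1 zero    = refl
∣minusOnePow∣≡1 (suc k) = trans (ℤ.∣-i∣≡∣i∣ (minusOnePow k)) (∣minusOnePow∣≡1 k)

squareFree⇒möbius≢0 : ∀ {y} → SquareFree y → möbius y ≢ ℤ.0ℤ
squareFree⇒möbius≢0 {y} y-squareFree
  with primeSquareDivisors y | no-primeSquareDivisors
  where
  no-primeSquareDivisors : primeSquareDivisors y ≡ []
  no-primeSquareDivisors = filter-none (λ p → prime? p ×-dec (p * p ∣? y)) {upTo (suc y)}
    (All.tabulate λ _ (p-prime , p²∣y) → y-squareFree (prime≥2 p-prime) p²∣y)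
... | [] | refl = λ μ≡0 →
  contradiction (trans (sym (∣minusOnePow∣≡1 (length (primeDivisors y)))) (cong ℤ.∣_∣ μ≡0)) λ ()

möbius≡0 : ∀ {y n} → 1 ≤ y → 2 ≤ n → n * n ∣ y → möbius y ≡ ℤ.0ℤ
möbius≡0 {y} 1≤y 2≤n n²∣y with prime-factor 2≤n
... | p , p-prime , p∣n
  with length (primeSquareDivisors y)
     | filter-some (λ p → prime? p ×-dec (p * p ∣? y)) p-square-divisor
  where
  p²∣y : p * p ∣ y
  p²∣y = ∣-trans (*-pres-∣ p∣n p∣n) n²∣y
  p-square-divisor : Any (λ p → Prime p × p * p ∣ y) (upTo (suc y))
  p-square-divisor = lose (∈-upTo⁺ (s≤s p≤y)) (p-prime , p²∣y)
    where
    p≤y : p ≤ y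
    p≤y = ≤-trans (m≤m*n p p {{prime⇒nonZero p-prime}}) (∣⇒≤ {{>-nonZero 1≤y}} p²∣y)
... | suc _ | _ = refl

module _ {q N : ℕ} .{{_ : NonZero N}} (X : DirichletCharacter q N) where
  open DirichletCharacter X

  μχ≡nothing : ∀ {y} → möbius y ≡ ℤ.0ℤ → μχ X y ≡ nothing
  μχ≡nothing {y} μ≡0 with möbius y | μ≡0 | χ y
  ... | _ | refl | nothing = refl
  ... | _ | refl | just _  = refl

  μχ≢nothing : ∀ {y} → möbius y ≢ ℤ.0ℤ → gcd y q ≡ 1 → μχ X y ≢ nothing
  μχ≢nothing {y} μ≢0 gcd≡1 with möbius y | χ y | Equivalence.to (vanishing y)
  ... | _          | nothing | gcd≢1 = λ _ → gcd≢1 refl gcd≡1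
  ... | ℤ.+ zero   | just _  | _     = contradiction refl μ≢0
  ... | ℤ.+ suc _  | just _  | _     = λ ()
  ... | ℤ.-[1+ _ ] | just _  | _     = λ ()

automatic⇒kernel-collision : ∀ {A : Set} {k} {t : ℕ → A} (l r : ℕ → ℕ) →
  (∀ j → r j < k ^ l j) → IsAutomatic k t →
  ∃[ i ] ∃[ j ] i < j × kernelSeq k (l i) (r i) t ≋ kernelSeq k (l j) (r j) t
automatic⇒kernel-collision {k = k} {t} l r r<k^l (L , kernel⊆L) =
  collide (pigeonhole ≤-refl (λ j → Any.index (kernel∈L j)))
  where
  kernel∈L : (j : Fin (suc (length L))) → Any (kernelSeq k (l (toℕ j)) (r (toℕ j)) t ≋_) L
  kernel∈L j = kernel⊆L (l (toℕ j)) (r (toℕ j)) (r<k^l (toℕ j))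

  collide : (∃₂ λ i j → toℕ i < toℕ j × Any.index (kernel∈L i) ≡ Any.index (kernel∈L j)) →
    ∃[ i ] ∃[ j ] i < j × kernelSeq k (l i) (r i) t ≋ kernelSeq k (l j) (r j) t
  collide (i , j , i<j , same-index) = toℕ i , toℕ j , i<j , λ n 1≤n →
    trans (lookup-index (kernel∈L i) n 1≤n)
          (trans (cong (λ s → lookup L s n) same-index)
                 (sym (lookup-index (kernel∈L j) n 1≤n)))

n<k^n : ∀ {k} → 2 ≤ k → ∀ n → n < k ^ n
n<k^n {k} 2≤k zero    = s≤s z≤n
n<k^n {k} 2≤k (suc n) = begin-strict
  suc n            <⟨ s≤s (n<k^n 2≤k n) ⟩
  1 + k ^ n        ≤⟨ +-monoˡ-≤ (k ^ n) (≤-trans (s≤s z≤n) (n<k^n 2≤k n)) ⟩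
  k ^ n + k ^ n    ≡⟨ cong (k ^ n +_) (+-identityʳ (k ^ n)) ⟨
  2 * k ^ n        ≤⟨ *-monoˡ-≤ (k ^ n) 2≤k ⟩
  k * k ^ n        ∎
  where open ≤-Reasoning

R P : ℕ → ℕ → ℕ
R c zero    = 1
R c (suc j) = R c j * (P c j * P c j)
P c j = suc (c * R c j)

1≤R : ∀ c j → 1 ≤ R c j
1≤R c zero    = ≤-refl
1≤R c (suc j) = *-mono-≤ (1≤R c j) (s≤s z≤n)

2≤P : ∀ {c} → 1 ≤ c → ∀ j → 2 ≤ P c j
2≤P {c} 1≤c j = s≤s (*-mono-≤ 1≤c (1≤R c j))

c⊥P : ∀ c j → Coprime c (P c j)
c⊥P c j = Coprime.sym (coprime-+-* (R c j) (1-coprimeTo c))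

c⊥R : ∀ c j → Coprime c (R c j)
c⊥R c zero    = Coprime.sym (1-coprimeTo c)
c⊥R c (suc j) = coprime-*ʳ (c⊥R c j) (coprime-*ʳ (c⊥P c j) (c⊥P c j))

R⊥P : ∀ c j → Coprime (R c j) (P c j)
R⊥P c j = Coprime.sym (subst (λ x → Coprime (suc x) (R c j)) (*-comm (R c j) c)
                              (coprime-+-* c (1-coprimeTo (R c j))))

P²∣R : ∀ c {i j} → i < j → P c i * P c i ∣ R c j
P²∣R c {i} {suc j} i<1+j with m≤n⇒m<n∨m≡n (s≤s⁻¹ i<1+j)
... | inj₁ i<j  = ∣m⇒∣m*n (P c j * P c j) (P²∣R c i<j)
... | inj₂ refl = ∣n⇒∣m*n (R c i) ∣-refl

module _ {q N : ℕ} .{{_ : NonZero q}} .{{_ : NonZero N}} (X : DirichletCharacter q N)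
         {k : ℕ} (2≤k : 2 ≤ k) where
  private
    c : ℕ
    c = k * q

    d : ℕ → ℕ
    d j = k ^ R c j * (P c j * P c j * q)

    R⊥q : ∀ j → Coprime (R c j) q
    R⊥q j = coprime-∣ʳ (Coprime.sym (c⊥R c j)) (∣n⇒∣m*n k ∣-refl)

    R⊥k : ∀ j → Coprime (R c j) k
    R⊥k j = coprime-∣ʳ (Coprime.sym (c⊥R c j)) (∣m⇒∣m*n q ∣-refl)

    R⊥d : ∀ j → Coprime (R c j) (d j)
    R⊥d j = coprime-*ʳ (coprime-^ʳ (R c j) (R⊥k j))
                       (coprime-*ʳ (coprime-*ʳ (R⊥P c j) (R⊥P c j)) (R⊥q j))

    R+d⊥d : ∀ j → Coprime (R c j + d j) (d j)
    R+d⊥d j = subst (λ x → Coprime (R c j + x) (d j)) (*-identityʳ (d j))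
                    (coprime-+-* 1 (R⊥d j))

    squareFree-term : ∀ j → ∃[ m ] SquareFree (R c j + d j + d j * m)
    squareFree-term j = squareFree-in-progression (≤-trans (1≤R c j) (m≤m+n _ _)) (R+d⊥d j)

    m : ℕ → ℕ
    m j = proj₁ (squareFree-term j)

    n : ℕ → ℕ
    n j = P c j * P c j * q * suc (m j)

    1≤n : ∀ j → 1 ≤ n j
    1≤n j = *-mono-≤ (*-mono-≤ {1} {P c j * P c j} (s≤s z≤n) (>-nonZero⁻¹ q)) (s≤s z≤n)

    kernel-term≡ : ∀ j → k ^ R c j * n j + R c j ≡ R c j + d j + d j * m j
    kernel-term≡ j = rearrange (k ^ R c j) (P c j * P c j) q (m j) (R c j)
      where
      rearrange : ∀ K P² q m r →
        K * (P² * q * suc m) + r ≡ r + K * (P² * q) + K * (P² * q) * m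
      rearrange = solve-∀

    kernel-value≢nothing : ∀ j → kernelSeq k (R c j) (R c j) (μχ X) (n j) ≢ nothing
    kernel-value≢nothing j = subst (λ y → μχ X y ≢ nothing) (sym (kernel-term≡ j))
      (μχ≢nothing X {R c j + d j + d j * m j}
        (squareFree⇒möbius≢0 (proj₂ (squareFree-term j)))
        (coprime⇒gcd≡1 (coprime-∣ʳ (coprime-+-* (m j) (R+d⊥d j)) q∣d)))
      where
      q∣d : q ∣ d j
      q∣d = ∣n⇒∣m*n (k ^ R c j) (∣n⇒∣m*n (P c j * P c j) ∣-refl)

    kernel-value≡nothing : ∀ {i j} → i < j → kernelSeq k (R c j) (R c j) (μχ X) (n i) ≡ nothing
    kernel-value≡nothing {i} {j} i<j =
      μχ≡nothing X {k ^ R c j * n i + R c j}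
        (möbius≡0 (≤-trans (1≤R c j) (m≤n+m _ _)) (2≤P 1≤c i) P²∣term)
      where
      1≤c : 1 ≤ c
      1≤c = *-mono-≤ (≤-trans (s≤s z≤n) 2≤k) (>-nonZero⁻¹ q)
      P²∣term : P c i * P c i ∣ k ^ R c j * n i + R c j
      P²∣term = ∣m∣n⇒∣m+n (∣n⇒∣m*n (k ^ R c j) (∣m⇒∣m*n (suc (m i)) (∣m⇒∣m*n q ∣-refl)))
                           (P²∣R c i<j)

  μχ-kernelSeqs-distinct : ∀ {i j} → i < j →
    ¬ (kernelSeq k (R (k * q) i) (R (k * q) i) (μχ X)
         ≋ kernelSeq k (R (k * q) j) (R (k * q) j) (μχ X))
  μχ-kernelSeqs-distinct {i} i<j same =
    kernel-value≢nothing i (trans (same (n i) (1≤n i)) (kernel-value≡nothing i<j))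

corollary2p10 : (q N : ℕ) .{{_ : NonZero q}} .{{_ : NonZero N}}
    → (X : DirichletCharacter q N)
    → (k : ℕ) → 2 ≤ k → ¬ IsAutomatic k (μχ X)
corollary2p10 q N X k 2≤k automatic =
  let i , j , i<j , same = automatic⇒kernel-collision {t = μχ X} (R (k * q)) (R (k * q))
                             (λ j → n<k^n 2≤k (R (k * q) j)) automatic
  in μχ-kernelSeqs-distinct X 2≤k i<j same
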